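{- For every integer $n\geq0$, $$\sum_{T\in\mathcal{LB}_{2n+1}}(-1)^{\mathsf{h}(T)}q^{\mathsf{inv}(T)}=(-1)^nT_{2n+1}(q).$$
   Context: A word $w=w_1\cdots w_j$ with distinct letters is unimodal if $w_1<\cdots<w_m>w_{m+1}>\cdots>w_j$ for some $1\le m\le j$; it is an odd unimodal permutation if moreover $j$ is odd. A complete binary tree is a rooted (plane) tree in which every internal node has a left child and a right child. A labeled binary tree on $[2n+1]$ is a complete binary tree whose nodes are labeled by odd unimodal permutations such that the sets of letters of all labels form a set partition of $[2n+1]$. $\mathcal{LB}_{2n+1}$ is the set of all labeled binary trees on $[2n+1]$, and for $T\in\mathcal{LB}_{2n+1}$, $\mathsf{h}(T)$ is half the number of edges of $T$. For $T$ with $2k+1$ nodes, let $w(T)=\alpha_1\alpha_2\cdots\alpha_{2k+1}$ be the concatenation of the labels, where $\alpha_i$ is the label of the $i$-th node of $T$ in in-order traversal (left subtree, node, right subtree); $w(T)$ is a permutation of $[2n+1]$, and $\mathsf{inv}(T)$ is the number of inversions of $w(T)$, i.e. the number of pairs $i<j$ with $w(T)_i>w(T)_j$. With $(q;q)_m=\prod_{i=1}^{m}(1-q^i)$, $\sin_q(x)=\sum_{m\geq0}(-1)^m\frac{x^{2m+1}}{(q;q)_{2m+1}}$, $\cos_q(x)=\sum_{m\geq0}(-1)^m\frac{x^{2m}}{(q;q)_{2m}}$, the $q$-tangent numbers are defined by $\frac{\sin_q(x)}{\cos_q(x)}=\sum_{m\geq0}T_{2m+1}(q)\frac{x^{2m+1}}{(q;q)_{2m+1}}$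 (equivalently, $T_{2m+1}(q)=\sum q^{\mathsf{inv}(\pi)}$ over down-up permutations $\pi_1>\pi_2<\pi_3>\cdots$ of $[2m+1]$). -}

module Defs where

open import Data.Nat using (ℕ; zero; suc; _+_; _*_; _<_; _≤_; _<?_; _≟_; ⌊_/2⌋)
open import Data.Integer using (ℤ; -1ℤ; 0ℤ; 1ℤ) renaming (_+_ to _+ℤ_; _*_ to _*ℤ_; _^_ to _^ℤ_)
open import Data.List using (List; []; _∷_; _++_; length; take; drop; filter; upTo; map)
open import Data.List.Relation.Unary.Linked using (Linked)
open import Data.List.Relation.Binary.Permutation.Propositional using (_↭_)
open import Data.List.Membership.Propositional using (_∈_)
open import Data.List.Relation.Unary.Unique.Propositional using (Unique)
open import Data.Product using (Σ; ∃; _×_)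
open import Data.Unit using (⊤)
open import Data.Bool using (Bool; true; false; if_then_else_)
open import Relation.Nullary.Decidable using (does)
open import Relation.Binary.PropositionalEquality using (_≡_)
open import Function.Bundles using (_⇔_)

interval : ℕ → List ℕ
interval m = map suc (upTo m)

inv : List ℕ → ℕ
inv [] = 0
inv (x ∷ xs) = length (filter (λ y → y <? x) xs) + inv xs

Increasing : List ℕ → Set
Increasing = Linked _<_

Decreasing : List ℕ → Set
Decreasing = Linked (λ a b → b < a)

-- w = w_1 ... w_j unimodal: w_1 < ... < w_m > w_{m+1} > ... > w_j for some 1 ≤ m ≤ j
Unimodal : List ℕ → Set
Unimodal w = Σ ℕ λ m → (1 ≤ m) × (m ≤ length w)
               × Increasing (take m w) × Decreasing (drop (m Data.Nat.∸ 1) w)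

-- odd unimodal permutation (word with distinct letters of odd length, unimodal;
-- distinctness follows from unimodality)
OddUnimodal : List ℕ → Set
OddUnimodal w = Unimodal w × (Σ ℕ λ k → length w ≡ suc (2 * k))

data Tree : Set where
  leaf : List ℕ → Tree
  node : Tree → List ℕ → Tree → Tree

AllLabels : (List ℕ → Set) → Tree → Set
AllLabels P (leaf a) = P a
AllLabels P (node l a r) = AllLabels P l × P a × AllLabels P r

word : Tree → List ℕ
word (leaf a) = a
word (node l a r) = word l ++ a ++ word r

edges : Tree → ℕ
edges (leaf _) = 0
edges (node l _ r) = edges l + edges r + 2

h : Tree → ℕ
h T = ⌊ edges T /2⌋

-- T ∈ LB_{2n+1}: labels are odd unimodal permutations whose letter sets
-- form a set partition of [2n+1] (i.e. the concatenation of all labels is a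
-- permutation of [2n+1])
LB : ℕ → Tree → Set
LB n T = AllLabels OddUnimodal T × (word T ↭ interval (suc (2 * n)))

alt : Bool → List ℕ → Set
alt b [] = ⊤
alt b (x ∷ []) = ⊤
alt true (x ∷ y ∷ r) = (y < x) × alt false (y ∷ r)
alt false (x ∷ y ∷ r) = (x < y) × alt true (y ∷ r)

DownUpPerm : ℕ → List ℕ → Set
DownUpPerm m π = (π ↭ interval m) × alt true π

Enumerates : {A : Set} → List A → (A → Set) → Set
Enumerates {A} xs P = Unique xs × ((x : A) → (x ∈ xs) ⇔ P x)

-- a polynomial in q with integer coefficients is represented by its
-- coefficient function: coeff k = [q^k].
-- genPoly xs wt st = Σ_{x ∈ xs} wt(x) q^{st(x)}
genPoly : {A : Set} → List A → (A → ℤ) → (A → ℕ) → ℕ → ℤ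
genPoly [] wt st k = 0ℤ
genPoly (x ∷ xs) wt st k =
  (if does (st x ≟ k) then wt x else 0ℤ) +ℤ genPoly xs wt st k

sign : ℕ → ℤ
sign m = -1ℤ ^ℤ m

-- q-tangent number T_{2m+1}(q) = Σ_{π down-up perm of [2m+1]} q^{inv π},
-- computed from an enumeration ps of the down-up permutations
qTangent : List (List ℕ) → ℕ → ℤ
qTangent ps = genPoly ps (λ _ → 1ℤ) inv

{-# OPTIONS --safe #-}
-- Integer-valued functions on words form a ring under the concatenation product
-- (F ⋆ G) w = ∑_{a ++ b = w} F a · G b, with unit ε. Let U = oddValleyFree be the
-- indicator of odd valley-free words (for distinct letters: the odd unimodal ones),
-- X = valleyFree that of all valley-free words, and E = signedDownUp the signed
-- indicator of down-up words, E w = (-1)^k on down-up words of length 2k+1.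
-- Splitting a labeled tree at its root shows that the signed number T w of labeled
-- trees with word w satisfies T = U - T ⋆ U ⋆ T, which determines T since U and T
-- vanish on the empty word. E satisfies the same equation: peeling off the first
-- valley gives E ⋆ X = X - ε, reversing words gives X ⋆ E = X - ε, and as
-- U = [odd] · X while E lives on odd words, E ⋆ U ⋆ E = U - E. Hence T = E, and
-- summing q^inv(w) E w over the permutations w of [2n+1] gives (-1)^n T_{2n+1}(q).
module Submission where

open import Defs
open import Data.Nat using (ℕ; suc; _*_)
open import Data.Integer using (ℤ) renaming (_*_ to _*ℤ_)
open import Data.List using (List)
open import Relation.Binary.PropositionalEquality using (_≡_)

open import Data.Bool using (true; false; if_then_else_)
open import Data.Empty using (⊥-elim)
open import Data.Integer using (0ℤ; 1ℤ; -1ℤ; _+_; _-_; -_)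
import Data.Integer.Properties as ℤ
open import Data.Integer.Tactic.RingSolver using (solve-∀)
open import Data.List
  using ([]; _∷_; [_]; _++_; length; reverse; map; concatMap; filter; cartesianProductWith; deduplicate; take; drop; upTo)
import Data.List.Properties as List
open import Data.List.Membership.Propositional using (_∈_; find; lose)
open import Data.List.Membership.Propositional.Properties
  using (∈-map⁺; ∈-map⁻; ∈-++⁺ˡ; ∈-++⁺ʳ; ∈-++⁻; ∈-concatMap⁺; ∈-concatMap⁻; ∈-cartesianProductWith⁺;
         ∈-cartesianProductWith⁻; ∈-filter⁺; ∈-filter⁻; ∈-deduplicate⁺; ∈-deduplicate⁻)
open import Data.List.Membership.Propositional.Properties.WithK using (unique∧set⇒bag)
open import Data.List.Relation.Binary.BagAndSetEquality using (_∼[_]_; set; ∼bag⇒↭)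
open import Data.List.Relation.Binary.Disjoint.Propositional using (Disjoint)
open import Data.List.Relation.Binary.Permutation.Propositional as ↭ using (_↭_; ↭-sym; ↭⇒↭ₛ)
open import Data.List.Relation.Binary.Permutation.Propositional.Properties using (↭-length)
import Data.List.Relation.Binary.Permutation.Setoid.Properties as ↭ₛ
open import Data.List.Relation.Unary.All as All using ([])
import Data.List.Relation.Unary.All.Properties as All
open import Data.List.Relation.Unary.Any using (here; there)
open import Data.List.Relation.Unary.Linked as Linked using (Linked; [-]; _∷_)
open import Data.List.Relation.Unary.Linked.Properties using (AllPairs⇒Linked)
open import Data.List.Relation.Unary.Unique.Propositional using (Unique; []; _∷_)
import Data.List.Relation.Unary.Unique.Propositional.Properties as Unique
import Data.List.Relation.Unary.Unique.DecPropositional.Properties as UniqueDec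
open import Data.Nat as ℕ using (zero; _<_; _≤_; _<?_; z≤n; s≤s; ⌊_/2⌋)
import Data.Nat.Properties as ℕ
import Data.Nat.Tactic.RingSolver as ℕ-Ring
open import Data.Parity as ℙ using (0ℙ; 1ℙ)
import Data.Parity.Properties as ℙ
open import Data.Product using (Σ; ∃; _×_; _,_; proj₁; proj₂; map₁; swap)
open import Data.Sum using (inj₁; inj₂)
open import Data.Unit using (tt)
open import Function using (_∘_; _⇔_; mk⇔; Equivalence)
import Function.Properties.Equivalence as ⇔
open import Relation.Binary.Definitions using (tri<; tri≈; tri>)
open import Relation.Binary.PropositionalEquality using (_≢_; refl; sym; trans; cong; cong₂; subst; module ≡-Reasoning)
open import Relation.Binary.PropositionalEquality.Properties using (setoid)
open import Relation.Nullary using (¬_; Dec; yes; no; does)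
open import Relation.Nullary.Decidable using (_×-dec_; ¬?; does-⇔; dec-true; dec-false)

∑ : {A : Set} → (A → ℤ) → List A → ℤ
∑ g [] = 0ℤ
∑ g (x ∷ xs) = g x + ∑ g xs

infix 5 ∑
syntax ∑ (λ x → e) xs = ∑[ x ∈ xs ] e

module _ {A : Set} where

  ∑-cong : ∀ {g h : A → ℤ} xs → (∀ {x} → x ∈ xs → g x ≡ h x) → ∑ g xs ≡ ∑ h xs
  ∑-cong [] g≡h = refl
  ∑-cong (x ∷ xs) g≡h = cong₂ _+_ (g≡h (here refl)) (∑-cong xs (g≡h ∘ there))

  ∑-++ : ∀ (g : A → ℤ) xs ys → ∑ g (xs ++ ys) ≡ ∑ g xs + ∑ g ys
  ∑-++ g [] ys = sym (ℤ.+-identityˡ _)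
  ∑-++ g (x ∷ xs) ys = trans (cong (g x +_) (∑-++ g xs ys)) (sym (ℤ.+-assoc (g x) _ _))

  ∑-*ˡ : ∀ c (g : A → ℤ) xs → ∑[ x ∈ xs ] c *ℤ g x ≡ c *ℤ ∑ g xs
  ∑-*ˡ c g [] = sym (ℤ.*-zeroʳ c)
  ∑-*ˡ c g (x ∷ xs) = trans (cong (c *ℤ g x +_) (∑-*ˡ c g xs)) (sym (ℤ.*-distribˡ-+ c (g x) _))

  ∑-- : ∀ (g h : A → ℤ) xs → ∑[ x ∈ xs ] (g x - h x) ≡ ∑ g xs - ∑ h xs
  ∑-- g h [] = refl
  ∑-- g h (x ∷ xs) = trans (cong (g x - h x +_) (∑-- g h xs)) (interchange (g x) (h x) (∑ g xs) (∑ h xs))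
    where
    interchange : ∀ a b c d → a - b + (c - d) ≡ a + c - (b + d)
    interchange = solve-∀

  ∑-↭ : ∀ (g : A → ℤ) {xs ys} → xs ↭ ys → ∑ g xs ≡ ∑ g ys
  ∑-↭ g ↭.refl = refl
  ∑-↭ g (↭.prep x p) = cong (g x +_) (∑-↭ g p)
  ∑-↭ g (↭.swap x y p) = trans (exchange (g x) (g y) _) (cong (λ s → g y + (g x + s)) (∑-↭ g p))
    where
    exchange : ∀ a b c → a + (b + c) ≡ b + (a + c)
    exchange = solve-∀
  ∑-↭ g (↭.trans p q) = trans (∑-↭ g p) (∑-↭ g q)

  ∑-∼set : ∀ (g : A → ℤ) {xs ys} → Unique xs → Unique ys → xs ∼[ set ] ys → ∑ g xs ≡ ∑ g ys
  ∑-∼set g xs! ys! xs∼ys = ∑-↭ g (∼bag⇒↭ (unique∧set⇒bag xs! ys! xs∼ys))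

  ∑-Enumerates : ∀ (g : A → ℤ) {P xs ys} → Enumerates xs P → Enumerates ys P → ∑ g xs ≡ ∑ g ys
  ∑-Enumerates g (xs! , ∈xs) (ys! , ∈ys) = ∑-∼set g xs! ys! (λ {x} → ⇔.trans (∈xs x) (⇔.sym (∈ys x)))

module _ {A B : Set} where

  ∑-map : ∀ (g : B → ℤ) (f : A → B) xs → ∑ g (map f xs) ≡ ∑ (g ∘ f) xs
  ∑-map g f [] = refl
  ∑-map g f (x ∷ xs) = cong (g (f x) +_) (∑-map g f xs)

  ∑-concatMap : ∀ (g : B → ℤ) (f : A → List B) xs → ∑ g (concatMap f xs) ≡ ∑[ x ∈ xs ] ∑ g (f x)
  ∑-concatMap g f [] = refl
  ∑-concatMap g f (x ∷ xs) = trans (∑-++ g (f x) _) (cong (∑ g (f x) +_) (∑-concatMap g f xs))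

module _ {A B C : Set} where

  ∑-product : ∀ (k : C → ℤ) (f : A → B → C) (g : A → ℤ) (h : B → ℤ) xs ys →
              (∀ x y → k (f x y) ≡ g x *ℤ h y) →
              ∑ k (cartesianProductWith f xs ys) ≡ ∑ g xs *ℤ ∑ h ys
  ∑-product k f g h [] ys k≡gh = refl
  ∑-product k f g h (x ∷ xs) ys k≡gh = begin
    ∑ k (map (f x) ys ++ cartesianProductWith f xs ys)   ≡⟨ ∑-++ k (map (f x) ys) _ ⟩
    ∑ k (map (f x) ys) + ∑ k (cartesianProductWith f xs ys)
      ≡⟨ cong₂ _+_ (trans (∑-map k (f x) ys) (∑-cong ys (λ {y} _ → k≡gh x y)))
                   (∑-product k f g h xs ys k≡gh) ⟩
    (∑[ y ∈ ys ] g x *ℤ h y) + ∑ g xs *ℤ ∑ h ys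
      ≡⟨ cong (_+ ∑ g xs *ℤ ∑ h ys) (∑-*ˡ (g x) h ys) ⟩
    g x *ℤ ∑ h ys + ∑ g xs *ℤ ∑ h ys                    ≡⟨ sym (ℤ.*-distribʳ-+ (∑ h ys) (g x) _) ⟩
    (g x + ∑ g xs) *ℤ ∑ h ys                            ∎
    where open ≡-Reasoning

𝟙 : {P : Set} → Dec P → ℤ
𝟙 P? = if does P? then 1ℤ else 0ℤ

module _ {P : Set} where

  𝟙-yes : (P? : Dec P) → P → 𝟙 P? ≡ 1ℤ
  𝟙-yes P? p rewrite dec-true P? p = refl

  𝟙-no : (P? : Dec P) → ¬ P → 𝟙 P? ≡ 0ℤ
  𝟙-no P? ¬p rewrite dec-false P? ¬p = refl

module _ {P Q : Set} where

  𝟙-⇔ : P ⇔ Q → (P? : Dec P) (Q? : Dec Q) → 𝟙 P? ≡ 𝟙 Q?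
  𝟙-⇔ P⇔Q P? Q? = cong (if_then 1ℤ else 0ℤ) (does-⇔ P⇔Q P? Q?)

  𝟙-× : (P? : Dec P) (Q? : Dec Q) → 𝟙 (P? ×-dec Q?) ≡ 𝟙 P? *ℤ 𝟙 Q?
  𝟙-× P? Q? with does P? | does Q?
  ... | true  | true  = refl
  ... | true  | false = refl
  ... | false | _     = refl

if-does≡𝟙* : ∀ {P : Set} (P? : Dec P) v → (if does P? then v else 0ℤ) ≡ 𝟙 P? *ℤ v
if-does≡𝟙* P? v with does P?
... | true  = sym (ℤ.*-identityˡ v)
... | false = refl

∑-filter : ∀ {A : Set} {P : A → Set} (P? : ∀ x → Dec (P x)) (g : A → ℤ) xs →
           ∑ g (filter P? xs) ≡ ∑[ x ∈ xs ] 𝟙 (P? x) *ℤ g x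
∑-filter P? g [] = refl
∑-filter P? g (x ∷ xs) with does (P? x)
... | true  = cong₂ _+_ (sym (ℤ.*-identityˡ (g x))) (∑-filter P? g xs)
... | false = trans (∑-filter P? g xs) (sym (ℤ.+-identityˡ _))

module _ {A : Set} {P : Set} where

  ∑-if : ∀ (P? : Dec P) (g : A → ℤ) xs → ∑ g (if does P? then xs else []) ≡ 𝟙 P? *ℤ ∑ g xs
  ∑-if (yes _) g xs = sym (ℤ.*-identityˡ (∑ g xs))
  ∑-if (no _) g xs = refl

  ∈-if⁻ : ∀ (P? : Dec P) {x : A} {xs} → x ∈ (if does P? then xs else []) → P × x ∈ xs
  ∈-if⁻ (yes p) x∈ = p , x∈
  ∈-if⁻ (no _) ()

  ∈-if⁺ : ∀ (P? : Dec P) {x : A} {xs} → P → x ∈ xs → x ∈ (if does P? then xs else [])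
  ∈-if⁺ (yes _) _ x∈ = x∈
  ∈-if⁺ (no ¬p) p _ = ⊥-elim (¬p p)

  if-unique : ∀ (P? : Dec P) {xs : List A} → Unique xs → Unique (if does P? then xs else [])
  if-unique (yes _) xs! = xs!
  if-unique (no _) _ = []

concatMap-unique : ∀ {A B : Set} (f : A → List B) (key : B → A) {xs} → Unique xs → (∀ x → Unique (f x)) →
                   (∀ x {y} → y ∈ f x → key y ≡ x) → Unique (concatMap f xs)
concatMap-unique f key [] f! key-f = []
concatMap-unique f key {x ∷ xs} (x∉xs ∷ xs!) f! key-f =
  Unique.++⁺ (f! x) (concatMap-unique f key xs! f! key-f) disjoint
  where
  disjoint : Disjoint (f x) (concatMap f xs)
  disjoint (y∈fx , y∈rest) with find (∈-concatMap⁻ f {xs = xs} y∈rest)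
  ... | x′ , x′∈xs , y∈fx′ = All.lookup x∉xs x′∈xs (trans (sym (key-f x y∈fx)) (key-f x′ y∈fx′))

Unique-++⁻ : ∀ {A : Set} (xs : List A) {ys} → Unique (xs ++ ys) → Unique xs × Unique ys
Unique-++⁻ [] ys! = [] , ys!
Unique-++⁻ (x ∷ xs) (x∉ ∷ xsys!) with Unique-++⁻ xs xsys!
... | xs! , ys! = All.++⁻ˡ xs x∉ ∷ xs! , ys!

genPoly≡∑ : ∀ {A : Set} (xs : List A) wt st k → genPoly xs wt st k ≡ ∑[ x ∈ xs ] 𝟙 (st x ℕ.≟ k) *ℤ wt x
genPoly≡∑ [] wt st k = refl
genPoly≡∑ (x ∷ xs) wt st k = cong₂ _+_ (if-does≡𝟙* (st x ℕ.≟ k) (wt x)) (genPoly≡∑ xs wt st k)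

-- The concatenation product of word functions

module _ {A : Set} where

  splits : List A → List (List A × List A)
  splits [] = [ ([] , []) ]
  splits (x ∷ w) = ([] , x ∷ w) ∷ map (map₁ (x ∷_)) (splits w)

  ∈-splits⁻ : ∀ w {a b} → (a , b) ∈ splits w → a ++ b ≡ w
  ∈-splits⁻ [] (here refl) = refl
  ∈-splits⁻ (x ∷ w) (here refl) = refl
  ∈-splits⁻ (x ∷ w) (there p∈) with ∈-map⁻ (map₁ (x ∷_)) p∈
  ... | _ , q∈ , refl = cong (x ∷_) (∈-splits⁻ w q∈)

  ∈-splits⁺ : ∀ a b → (a , b) ∈ splits (a ++ b)
  ∈-splits⁺ [] [] = here refl
  ∈-splits⁺ [] (y ∷ b) = here refl
  ∈-splits⁺ (x ∷ a) b = there (∈-map⁺ (map₁ (x ∷_)) (∈-splits⁺ a b))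

  splits-unique : ∀ w → Unique (splits w)
  splits-unique [] = [] ∷ []
  splits-unique (x ∷ w) =
    All.map⁺ (All.tabulate (λ _ ())) ∷ Unique.map⁺ map₁-injective (splits-unique w)
    where
    map₁-injective : ∀ {p q : List A × List A} → map₁ (x ∷_) p ≡ map₁ (x ∷_) q → p ≡ q
    map₁-injective refl = refl

  infixl 7 _⋆_

  _⋆_ : (List A → ℤ) → (List A → ℤ) → List A → ℤ
  (F ⋆ G) w = ∑[ p ∈ splits w ] F (proj₁ p) *ℤ G (proj₂ p)

  ε : List A → ℤ
  ε [] = 1ℤ
  ε (_ ∷ _) = 0ℤ

  ⋆-cong : ∀ {F G F′ G′ : List A → ℤ} w → (∀ a b → a ++ b ≡ w → F a *ℤ G b ≡ F′ a *ℤ G′ b) →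
           (F ⋆ G) w ≡ (F′ ⋆ G′) w
  ⋆-cong w FG≡ = ∑-cong (splits w) (λ {p} p∈ → FG≡ (proj₁ p) (proj₂ p) (∈-splits⁻ w p∈))

  ⋆-cong₂ : ∀ {F G F′ G′ : List A → ℤ} w →
            (∀ a b → a ++ b ≡ w → F a ≡ F′ a) → (∀ a b → a ++ b ≡ w → G b ≡ G′ b) →
            (F ⋆ G) w ≡ (F′ ⋆ G′) w
  ⋆-cong₂ {F} {G} {F′} {G′} w F≈F′ G≈G′ =
    ⋆-cong {F} {G} {F′} {G′} w (λ a b ab≡w → cong₂ _*ℤ_ (F≈F′ a b ab≡w) (G≈G′ a b ab≡w))

  ⋆-∷ : ∀ (F G : List A → ℤ) x w → (F ⋆ G) (x ∷ w) ≡ F [] *ℤ G (x ∷ w) + ((F ∘ (x ∷_)) ⋆ G) w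
  ⋆-∷ F G x w = cong (F [] *ℤ G (x ∷ w) +_) (∑-map _ (map₁ (x ∷_)) (splits w))

  ⋆-∷₀ : ∀ (F G : List A → ℤ) x w → F [] ≡ 0ℤ → (F ⋆ G) (x ∷ w) ≡ ((F ∘ (x ∷_)) ⋆ G) w
  ⋆-∷₀ F G x w F[]≡0 =
    trans (⋆-∷ F G x w)
          (trans (cong (λ c → c *ℤ G (x ∷ w) + ((F ∘ (x ∷_)) ⋆ G) w) F[]≡0) (ℤ.+-identityˡ _))

  ⋆-identityʳ : ∀ (F : List A → ℤ) w → (F ⋆ ε) w ≡ F w
  ⋆-identityʳ F [] = trans (ℤ.+-identityʳ _) (ℤ.*-identityʳ (F []))
  ⋆-identityʳ F (x ∷ w) = begin
    (F ⋆ ε) (x ∷ w)                              ≡⟨ ⋆-∷ F ε x w ⟩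
    F [] *ℤ 0ℤ + ((F ∘ (x ∷_)) ⋆ ε) w
      ≡⟨ cong (_+ ((F ∘ (x ∷_)) ⋆ ε) w) (ℤ.*-zeroʳ (F [])) ⟩
    0ℤ + ((F ∘ (x ∷_)) ⋆ ε) w                    ≡⟨ ℤ.+-identityˡ _ ⟩
    ((F ∘ (x ∷_)) ⋆ ε) w                         ≡⟨ ⋆-identityʳ (F ∘ (x ∷_)) w ⟩
    F (x ∷ w)                                    ∎
    where open ≡-Reasoning

  ⋆-*ˡ : ∀ c (F G : List A → ℤ) w → ((λ a → c *ℤ F a) ⋆ G) w ≡ c *ℤ (F ⋆ G) w
  ⋆-*ˡ c F G w = trans (∑-cong (splits w) (λ _ → ℤ.*-assoc c _ _)) (∑-*ˡ c _ (splits w))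

  ⋆-linearʳ : ∀ c (F G H : List A → ℤ) w →
              (F ⋆ (λ b → c *ℤ G b - H b)) w ≡ c *ℤ (F ⋆ G) w - (F ⋆ H) w
  ⋆-linearʳ c F G H w = begin
    (F ⋆ (λ b → c *ℤ G b - H b)) w
      ≡⟨ ∑-cong (splits w) (λ {p} _ → distrib c (F (proj₁ p)) (G (proj₂ p)) (H (proj₂ p))) ⟩
    ∑[ p ∈ splits w ] (c *ℤ (F (proj₁ p) *ℤ G (proj₂ p)) - F (proj₁ p) *ℤ H (proj₂ p))
      ≡⟨ ∑-- _ _ (splits w) ⟩
    (∑[ p ∈ splits w ] c *ℤ (F (proj₁ p) *ℤ G (proj₂ p))) - (F ⋆ H) w
      ≡⟨ cong (_- (F ⋆ H) w) (∑-*ˡ c _ (splits w)) ⟩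
    c *ℤ (F ⋆ G) w - (F ⋆ H) w
      ∎
    where
    open ≡-Reasoning
    distrib : ∀ c f g h → f *ℤ (c *ℤ g - h) ≡ c *ℤ (f *ℤ g) - f *ℤ h
    distrib = solve-∀

  ⋆-local : ∀ {F F′ G G′ : List A → ℤ} w →
            F [] ≡ 0ℤ → F′ [] ≡ 0ℤ → G [] ≡ 0ℤ → G′ [] ≡ 0ℤ →
            (∀ v → length v < length w → F v ≡ F′ v) →
            (∀ v → length v < length w → G v ≡ G′ v) →
            (F ⋆ G) w ≡ (F′ ⋆ G′) w
  ⋆-local {F} {F′} {G} {G′} w F₀ F′₀ G₀ G′₀ F≈F′ G≈G′ = ⋆-cong {F} {G} {F′} {G′} w agree
    where
    agree : ∀ a b → a ++ b ≡ w → F a *ℤ G b ≡ F′ a *ℤ G′ b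
    agree [] b _ = trans (cong (_*ℤ G b) F₀) (sym (cong (_*ℤ G′ b) F′₀))
    agree a@(_ ∷ _) [] _ =
      trans (trans (cong (F a *ℤ_) G₀) (ℤ.*-zeroʳ (F a)))
            (sym (trans (cong (F′ a *ℤ_) G′₀) (ℤ.*-zeroʳ (F′ a))))
    agree a@(_ ∷ _) b@(_ ∷ _) refl = cong₂ _*ℤ_ (F≈F′ a a<w) (G≈G′ b b<w)
      where
      a<w : length a < length (a ++ b)
      a<w = subst (length a <_) (sym (List.length-++ a)) (ℕ.m<m+n (length a) (s≤s z≤n))
      b<w : length b < length (a ++ b)
      b<w = subst (length b <_) (sym (List.length-++ a)) (ℕ.m<n+m (length b) (s≤s z≤n))

  reverseSplit : List A × List A → List A × List A
  reverseSplit (a , b) = reverse b , reverse a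

  reverseSplit-involutive : ∀ p → reverseSplit (reverseSplit p) ≡ p
  reverseSplit-involutive (a , b) = cong₂ _,_ (List.reverse-involutive a) (List.reverse-involutive b)

  reverseSplit-injective : ∀ {p q} → reverseSplit p ≡ reverseSplit q → p ≡ q
  reverseSplit-injective {p} {q} eq =
    trans (sym (reverseSplit-involutive p)) (trans (cong reverseSplit eq) (reverseSplit-involutive q))

  ∈-splits-reverse : ∀ w {p} → p ∈ splits (reverse w) ⇔ p ∈ map reverseSplit (splits w)
  ∈-splits-reverse w {a , b} = mk⇔ to from
    where
    to : (a , b) ∈ splits (reverse w) → (a , b) ∈ map reverseSplit (splits w)
    to ab∈ = subst (_∈ map reverseSplit (splits w)) (reverseSplit-involutive (a , b))
               (∈-map⁺ reverseSplit (subst (λ v → (reverse b , reverse a) ∈ splits v) ba≡w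
                 (∈-splits⁺ (reverse b) (reverse a))))
      where
      ba≡w : reverse b ++ reverse a ≡ w
      ba≡w = trans (sym (List.reverse-++ a b)) (List.reverse-selfInverse (sym (∈-splits⁻ (reverse w) ab∈)))
    from : (a , b) ∈ map reverseSplit (splits w) → (a , b) ∈ splits (reverse w)
    from ab∈ with ∈-map⁻ reverseSplit ab∈
    ... | (c , d) , cd∈ , refl = subst (λ v → (reverse d , reverse c) ∈ splits v) dc≡w
                                   (∈-splits⁺ (reverse d) (reverse c))
      where
      dc≡w : reverse d ++ reverse c ≡ reverse w
      dc≡w = trans (sym (List.reverse-++ c d)) (cong reverse (∈-splits⁻ w cd∈))

  ⋆-reverse : ∀ (F G : List A → ℤ) w → (F ⋆ G) (reverse w) ≡ ((G ∘ reverse) ⋆ (F ∘ reverse)) w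
  ⋆-reverse F G w = begin
    (F ⋆ G) (reverse w)
      ≡⟨ ∑-∼set _ (splits-unique (reverse w)) (Unique.map⁺ reverseSplit-injective (splits-unique w))
                (∈-splits-reverse w) ⟩
    ∑[ p ∈ map reverseSplit (splits w) ] F (proj₁ p) *ℤ G (proj₂ p)
      ≡⟨ ∑-map _ reverseSplit (splits w) ⟩
    ∑[ p ∈ splits w ] F (reverse (proj₂ p)) *ℤ G (reverse (proj₁ p))
      ≡⟨ ∑-cong (splits w) (λ {p} _ → ℤ.*-comm (F (reverse (proj₂ p))) (G (reverse (proj₁ p)))) ⟩
    ((G ∘ reverse) ⋆ (F ∘ reverse)) w
      ∎
    where open ≡-Reasoning

  ε-reverse : ∀ w → ε (reverse w) ≡ ε w
  ε-reverse [] = refl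
  ε-reverse (x ∷ w) = trans (cong ε (List.unfold-reverse x w)) (ε-∷ʳ (reverse w))
    where
    ε-∷ʳ : ∀ u → ε (u ++ [ x ]) ≡ 0ℤ
    ε-∷ʳ [] = refl
    ε-∷ʳ (_ ∷ _) = refl

-- Odd words, valleys and unimodality

module _ {A : Set} where

  Odd Even : List A → Set
  Odd w = ℕ.parity (length w) ≡ 1ℙ
  Even w = ℕ.parity (length w) ≡ 0ℙ

  odd? : ∀ w → Dec (Odd w)
  odd? w = ℕ.parity (length w) ℙ.≟ 1ℙ

  even? : ∀ w → Dec (Even w)
  even? w = ℕ.parity (length w) ℙ.≟ 0ℙ

  parity-++ : ∀ (a b : List A) → ℕ.parity (length (a ++ b)) ≡ ℕ.parity (length a) ℙ.+ ℕ.parity (length b)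
  parity-++ a b = trans (cong ℕ.parity (List.length-++ a)) (ℙ.+-homo-+ (length a) (length b))

  Odd⇔Even-++ʳ : ∀ a b → Odd b → Odd a ⇔ Even (a ++ b)
  Odd⇔Even-++ʳ a b b-odd rewrite parity-++ a b | b-odd with ℕ.parity (length a)
  ... | 0ℙ = mk⇔ (λ ()) (λ ())
  ... | 1ℙ = mk⇔ (λ _ → refl) (λ _ → refl)

  Even⇔Odd-++ˡ : ∀ a b → Odd a → Even b ⇔ Odd (a ++ b)
  Even⇔Odd-++ˡ a b a-odd rewrite parity-++ a b | a-odd with ℕ.parity (length b)
  ... | 0ℙ = mk⇔ (λ _ → refl) (λ _ → refl)
  ... | 1ℙ = mk⇔ (λ ()) (λ ())

  length≡1+2k⇒Odd : ∀ w {k} → length w ≡ suc (2 * k) → Odd w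
  length≡1+2k⇒Odd w {k} |w|≡1+2k =
    trans (cong ℕ.parity |w|≡1+2k) (trans (ℙ.+-homo-+ 1 (2 * k)) (cong (1ℙ ℙ.+_) (ℙ.*-homo-* 2 k)))

  Odd⇒length≡1+2k : ∀ w → Odd w → Σ ℕ λ k → length w ≡ suc (2 * k)
  Odd⇒length≡1+2k w = odd (length w)
    where
    odd : ∀ n → ℕ.parity n ≡ 1ℙ → Σ ℕ λ k → n ≡ suc (2 * k)
    odd (suc zero) _ = 0 , refl
    odd (suc (suc n)) n-odd with odd n n-odd
    ... | k , n≡1+2k = suc k , trans (cong (suc ∘ suc) n≡1+2k) (cong suc (sym (ℕ.*-suc 2 k)))

  Odd⇒0<length : ∀ w → Odd w → 0 < length w
  Odd⇒0<length (_ ∷ _) _ = s≤s z≤n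

  length-<-++-middleˡ : ∀ (a u b : List A) → 0 < length u → length a < length (a ++ u ++ b)
  length-<-++-middleˡ a u b 0<u = subst (length a <_) (sym (List.length-++ a))
    (ℕ.m<m+n (length a) (ℕ.<-≤-trans 0<u (List.length-++-≤ˡ u)))

  length-<-++-middleʳ : ∀ (a u b : List A) → 0 < length u → length b < length (a ++ u ++ b)
  length-<-++-middleʳ a u b 0<u = ℕ.<-≤-trans b<ub (List.length-++-≤ʳ (u ++ b) {a})
    where
    b<ub : length b < length (u ++ b)
    b<ub = subst (length b <_) (sym (List.length-++ u)) (ℕ.m<n+m (length b) 0<u)

Valley : ℕ → ℕ → ℕ → Set
Valley x y z = y < x × y < z

valley? : ∀ x y z → Dec (Valley x y z)
valley? x y z = (y <? x) ×-dec (y <? z)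

data HasValley : List ℕ → Set where
  here  : ∀ {x y z r} → Valley x y z → HasValley (x ∷ y ∷ z ∷ r)
  there : ∀ {x w} → HasValley w → HasValley (x ∷ w)

hasValley? : ∀ w → Dec (HasValley w)
hasValley? [] = no λ ()
hasValley? (x ∷ []) = no λ { (there ()) }
hasValley? (x ∷ y ∷ []) = no λ { (there (there ())) }
hasValley? (x ∷ y ∷ z ∷ r) with valley? x y z | hasValley? (y ∷ z ∷ r)
... | yes v  | _      = yes (here v)
... | no  _  | yes h  = yes (there h)
... | no  ¬v | no  ¬h = no λ { (here v) → ¬v v ; (there h) → ¬h h }

HasValley-++ˡ : ∀ {u} v → HasValley u → HasValley (u ++ v)
HasValley-++ˡ v (here vxyz) = here vxyz
HasValley-++ˡ v (there h) = there (HasValley-++ˡ v h)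

HasValley-++ʳ : ∀ u {v} → HasValley v → HasValley (u ++ v)
HasValley-++ʳ [] h = h
HasValley-++ʳ (x ∷ u) h = there (HasValley-++ʳ u h)

HasValley-reverse : ∀ {w} → HasValley w → HasValley (reverse w)
HasValley-reverse (here {x} {y} {z} {r} v) =
  subst HasValley (sym (List.reverse-++ (x ∷ y ∷ z ∷ []) r)) (HasValley-++ʳ (reverse r) (here (swap v)))
HasValley-reverse (there {x} {w} h) =
  subst HasValley (sym (List.unfold-reverse x w)) (HasValley-++ˡ [ x ] (HasValley-reverse h))

valleyFree : List ℕ → ℤ
valleyFree w = 𝟙 (¬? (hasValley? w))

valleyFree-reverse : ∀ w → valleyFree (reverse w) ≡ valleyFree w
valleyFree-reverse w =
  𝟙-⇔ (mk⇔ (λ ¬h h → ¬h (HasValley-reverse h)) (λ ¬h h → ¬h (unreverse h)))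
      (¬? (hasValley? (reverse w))) (¬? (hasValley? w))
  where
  unreverse : HasValley (reverse w) → HasValley w
  unreverse h = subst HasValley (List.reverse-involutive w) (HasValley-reverse h)

valleyFree-∷ : ∀ {x w} → (HasValley (x ∷ w) → HasValley w) → valleyFree (x ∷ w) ≡ valleyFree w
valleyFree-∷ {x} {w} drop =
  𝟙-⇔ (mk⇔ (λ ¬h h → ¬h (there h)) (λ ¬h h → ¬h (drop h)))
      (¬? (hasValley? (x ∷ w))) (¬? (hasValley? w))

valleyFree-recurrence : ∀ x y z r (v? : Dec (Valley x y z)) →
                        valleyFree (y ∷ z ∷ r) - 𝟙 v? *ℤ valleyFree (z ∷ r) ≡ valleyFree (x ∷ y ∷ z ∷ r)
valleyFree-recurrence x y z r (yes (y<x , y<z)) = begin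
  valleyFree (y ∷ z ∷ r) - 1ℤ *ℤ valleyFree (z ∷ r)
    ≡⟨ cong (_- 1ℤ *ℤ valleyFree (z ∷ r)) (valleyFree-∷ ascent) ⟩
  valleyFree (z ∷ r) - 1ℤ *ℤ valleyFree (z ∷ r)
    ≡⟨ cancel (valleyFree (z ∷ r)) ⟩
  0ℤ
    ≡⟨ sym (𝟙-no (¬? (hasValley? (x ∷ y ∷ z ∷ r))) (λ ¬h → ¬h (here (y<x , y<z)))) ⟩
  valleyFree (x ∷ y ∷ z ∷ r)
    ∎
  where
  open ≡-Reasoning
  ascent : HasValley (y ∷ z ∷ r) → HasValley (z ∷ r)
  ascent (here (z<y , _)) = ⊥-elim (ℕ.<-asym y<z z<y)
  ascent (there h) = h
  cancel : ∀ a → a - 1ℤ *ℤ a ≡ 0ℤ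
  cancel = solve-∀
valleyFree-recurrence x y z r (no ¬v) = trans (ℤ.+-identityʳ _) (sym (valleyFree-∷ not-valley))
  where
  not-valley : HasValley (x ∷ y ∷ z ∷ r) → HasValley (y ∷ z ∷ r)
  not-valley (here v) = ⊥-elim (¬v v)
  not-valley (there h) = h

Decreasing⇒¬HasValley : ∀ {w} → Decreasing w → ¬ HasValley w
Decreasing⇒¬HasValley (_ ∷ z<y ∷ _) (here (_ , y<z)) = ℕ.<-asym y<z z<y
Decreasing⇒¬HasValley [-] (there ())
Decreasing⇒¬HasValley (_ ∷ dec) (there h) = Decreasing⇒¬HasValley dec h

Unimodal⇒¬HasValley : ∀ {w} → Unimodal w → ¬ HasValley w
Unimodal⇒¬HasValley (suc m , _ , _ , inc , dec) = ascending m _ inc dec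
  where
  ascending : ∀ m w → Increasing (take (suc m) w) → Decreasing (drop m w) → ¬ HasValley w
  ascending zero w _ dec = Decreasing⇒¬HasValley dec
  ascending (suc m) (x ∷ y ∷ r) (x<y ∷ _) _ (here (y<x , _)) = ℕ.<-asym x<y y<x
  ascending (suc m) (x ∷ y ∷ r) (_ ∷ inc) dec (there h) = ascending m (y ∷ r) inc dec h
  ascending (suc m) (x ∷ []) _ _ (there ())

descent⇒Decreasing : ∀ {x y r} → y < x → Linked _≢_ (x ∷ y ∷ r) → ¬ HasValley (x ∷ y ∷ r) →
                     Decreasing (x ∷ y ∷ r)
descent⇒Decreasing {r = []} y<x _ _ = y<x ∷ [-]
descent⇒Decreasing {x} {y} {z ∷ r} y<x (_ ∷ distinct) no-valley with ℕ.<-cmp y z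
... | tri< y<z _ _ = ⊥-elim (no-valley (here (y<x , y<z)))
... | tri≈ _ y≡z _ = ⊥-elim (Linked.head distinct y≡z)
... | tri> _ _ z<y = y<x ∷ descent⇒Decreasing z<y distinct (no-valley ∘ there)

¬HasValley⇒Unimodal : ∀ x r → Linked _≢_ (x ∷ r) → ¬ HasValley (x ∷ r) → Unimodal (x ∷ r)
¬HasValley⇒Unimodal x [] _ _ = 1 , s≤s z≤n , s≤s z≤n , [-] , [-]
¬HasValley⇒Unimodal x (y ∷ r) distinct no-valley with ℕ.<-cmp x y
... | tri< x<y _ _ with ¬HasValley⇒Unimodal y r (Linked.tail distinct) (no-valley ∘ there)
...   | suc m , _ , m≤ , inc , dec = suc (suc m) , s≤s z≤n , s≤s m≤ , x<y ∷ inc , dec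
¬HasValley⇒Unimodal x (y ∷ r) distinct no-valley | tri≈ _ x≡y _ = ⊥-elim (Linked.head distinct x≡y)
¬HasValley⇒Unimodal x (y ∷ r) distinct no-valley | tri> _ _ y<x =
  1 , s≤s z≤n , s≤s z≤n , [-] , descent⇒Decreasing y<x distinct no-valley

OddValleyFree : List ℕ → Set
OddValleyFree u = Odd u × ¬ HasValley u

oddValleyFree? : ∀ u → Dec (OddValleyFree u)
oddValleyFree? u = odd? u ×-dec ¬? (hasValley? u)

oddValleyFree : List ℕ → ℤ
oddValleyFree u = 𝟙 (oddValleyFree? u)

OddUnimodal⇒OddValleyFree : ∀ {u} → OddUnimodal u → OddValleyFree u
OddUnimodal⇒OddValleyFree {u} (unimodal , k , |u|≡1+2k) =
  length≡1+2k⇒Odd u {k} |u|≡1+2k , Unimodal⇒¬HasValley unimodal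

OddValleyFree⇒OddUnimodal : ∀ {u} → Unique u → OddValleyFree u → OddUnimodal u
OddValleyFree⇒OddUnimodal {x ∷ r} u! (u-odd , no-valley) =
  ¬HasValley⇒Unimodal x r (AllPairs⇒Linked u!) no-valley , Odd⇒length≡1+2k (x ∷ r) u-odd

-- Signed down-up words

data DownUp : List ℕ → Set where
  single : ∀ x → DownUp [ x ]
  _∷_    : ∀ {x y z r} → Valley x y z → DownUp (z ∷ r) → DownUp (x ∷ y ∷ z ∷ r)

downUp? : ∀ w → Dec (DownUp w)
downUp? [] = no λ ()
downUp? (x ∷ []) = yes (single x)
downUp? (x ∷ y ∷ []) = no λ ()
downUp? (x ∷ y ∷ z ∷ r) with valley? x y z | downUp? (z ∷ r)
... | yes v  | yes d  = yes (v ∷ d)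
... | no  ¬v | _      = no λ { (v ∷ _) → ¬v v }
... | yes _  | no  ¬d = no λ { (_ ∷ d) → ¬d d }

DownUp-odd : ∀ {w} → DownUp w → Odd w
DownUp-odd (single _) = refl
DownUp-odd (_ ∷ d) = DownUp-odd d

DownUp-extendʳ : ∀ u {x y z} → Valley z y x → DownUp (u ++ [ z ]) → DownUp (u ++ z ∷ y ∷ x ∷ [])
DownUp-extendʳ [] {x} v (single _) = v ∷ single x
DownUp-extendʳ (a ∷ []) v ()
DownUp-extendʳ (a ∷ b ∷ []) {x} v (v′ ∷ single _) = v′ ∷ (v ∷ single x)
DownUp-extendʳ (a ∷ b ∷ c ∷ u) v (v′ ∷ d) = v′ ∷ DownUp-extendʳ (c ∷ u) v d

DownUp-reverse : ∀ {w} → DownUp w → DownUp (reverse w)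
DownUp-reverse (single x) = single x
DownUp-reverse (_∷_ {x} {y} {z} {r} v d) =
  subst DownUp (sym (List.reverse-++ (x ∷ y ∷ z ∷ []) r))
    (DownUp-extendʳ (reverse r) (swap v) (subst DownUp (List.unfold-reverse z r) (DownUp-reverse d)))

signedDownUp : List ℕ → ℤ
signedDownUp [] = 0ℤ
signedDownUp (x ∷ []) = 1ℤ
signedDownUp (x ∷ y ∷ []) = 0ℤ
signedDownUp (x ∷ y ∷ z ∷ r) = - 𝟙 (valley? x y z) *ℤ signedDownUp (z ∷ r)

signedDownUp-DownUp : ∀ {w} → DownUp w → signedDownUp w ≡ sign ⌊ length w /2⌋
signedDownUp-DownUp (single _) = refl
signedDownUp-DownUp {x ∷ y ∷ z ∷ r} (v ∷ d) =
  cong₂ (λ c e → - c *ℤ e) (𝟙-yes (valley? x y z) v) (signedDownUp-DownUp d)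

signedDownUp-¬DownUp : ∀ w → ¬ DownUp w → signedDownUp w ≡ 0ℤ
signedDownUp-¬DownUp [] _ = refl
signedDownUp-¬DownUp (x ∷ []) ¬d = ⊥-elim (¬d (single x))
signedDownUp-¬DownUp (x ∷ y ∷ []) _ = refl
signedDownUp-¬DownUp (x ∷ y ∷ z ∷ r) ¬d = by-cases (valley? x y z) (signedDownUp-¬DownUp (z ∷ r))
  where
  by-cases : (v? : Dec (Valley x y z)) → (¬ DownUp (z ∷ r) → signedDownUp (z ∷ r) ≡ 0ℤ) →
             - 𝟙 v? *ℤ signedDownUp (z ∷ r) ≡ 0ℤ
  by-cases (yes v) ih = cong (-1ℤ *ℤ_) (ih (λ d → ¬d (v ∷ d)))
  by-cases (no _) _ = refl

signedDownUp-reverse : ∀ w → signedDownUp (reverse w) ≡ signedDownUp w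
signedDownUp-reverse w with downUp? w
... | yes d = begin
  signedDownUp (reverse w)           ≡⟨ signedDownUp-DownUp (DownUp-reverse d) ⟩
  sign ⌊ length (reverse w) /2⌋      ≡⟨ cong (λ n → sign ⌊ n /2⌋) (List.length-reverse w) ⟩
  sign ⌊ length w /2⌋                ≡⟨ sym (signedDownUp-DownUp d) ⟩
  signedDownUp w                     ∎
  where open ≡-Reasoning
... | no ¬d = trans (signedDownUp-¬DownUp (reverse w) (¬d ∘ unreverse)) (sym (signedDownUp-¬DownUp w ¬d))
  where
  unreverse : DownUp (reverse w) → DownUp w
  unreverse d = subst DownUp (List.reverse-involutive w) (DownUp-reverse d)

*-signedDownUp-cong : ∀ {c c′} b → (Odd b → c ≡ c′) → c *ℤ signedDownUp b ≡ c′ *ℤ signedDownUp b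
*-signedDownUp-cong {c} {c′} b c≡c′ with downUp? b
... | yes d = cong (_*ℤ signedDownUp b) (c≡c′ (DownUp-odd d))
... | no ¬d rewrite signedDownUp-¬DownUp b ¬d = trans (ℤ.*-zeroʳ c) (sym (ℤ.*-zeroʳ c′))

signedDownUp-*-cong : ∀ a {c c′} → (Odd a → c ≡ c′) → signedDownUp a *ℤ c ≡ signedDownUp a *ℤ c′
signedDownUp-*-cong a {c} {c′} c≡c′ =
  trans (ℤ.*-comm (signedDownUp a) c) (trans (*-signedDownUp-cong a c≡c′) (ℤ.*-comm c′ (signedDownUp a)))

alt? : ∀ b w → Dec (alt b w)
alt? b [] = yes tt
alt? b (x ∷ []) = yes tt
alt? true (x ∷ y ∷ r) = (y <? x) ×-dec alt? false (y ∷ r)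
alt? false (x ∷ y ∷ r) = (x <? y) ×-dec alt? true (y ∷ r)

signedDownUp-alt : ∀ n w → length w ≡ suc (2 * n) → signedDownUp w ≡ sign n *ℤ 𝟙 (alt? true w)
signedDownUp-alt zero (x ∷ []) _ = refl
signedDownUp-alt (suc n) (x ∷ y ∷ z ∷ r) |w|≡3+2n = begin
  - 𝟙 (valley? x y z) *ℤ signedDownUp (z ∷ r)
    ≡⟨ cong₂ (λ v e → - v *ℤ e) (𝟙-× (y <? x) (y <? z)) (signedDownUp-alt n (z ∷ r) |zr|≡1+2n) ⟩
  - (𝟙 (y <? x) *ℤ 𝟙 (y <? z)) *ℤ (sign n *ℤ a)
    ≡⟨ regroup (𝟙 (y <? x)) (𝟙 (y <? z)) (sign n) a ⟩
  sign (suc n) *ℤ (𝟙 (y <? x) *ℤ (𝟙 (y <? z) *ℤ a))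
    ≡⟨ cong (sign (suc n) *ℤ_) (sym alt-xyz) ⟩
  sign (suc n) *ℤ 𝟙 (alt? true (x ∷ y ∷ z ∷ r))
    ∎
  where
  open ≡-Reasoning
  a : ℤ
  a = 𝟙 (alt? true (z ∷ r))
  alt-xyz : 𝟙 (alt? true (x ∷ y ∷ z ∷ r)) ≡ 𝟙 (y <? x) *ℤ (𝟙 (y <? z) *ℤ a)
  alt-xyz = trans (𝟙-× (y <? x) ((y <? z) ×-dec alt? true (z ∷ r)))
                  (cong (𝟙 (y <? x) *ℤ_) (𝟙-× (y <? z) (alt? true (z ∷ r))))
  |zr|≡1+2n : length (z ∷ r) ≡ suc (2 * n)
  |zr|≡1+2n = ℕ.suc-injective (ℕ.suc-injective (trans |w|≡3+2n (cong suc (ℕ.*-suc 2 n))))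
  regroup : ∀ p q s a → - (p *ℤ q) *ℤ (s *ℤ a) ≡ -1ℤ *ℤ s *ℤ (p *ℤ (q *ℤ a))
  regroup = solve-∀
signedDownUp-alt zero (x ∷ y ∷ _) ()
signedDownUp-alt (suc n) (x ∷ []) ()
signedDownUp-alt (suc n) (x ∷ y ∷ []) |w|≡3+2n with () ← trans |w|≡3+2n (cong suc (ℕ.*-suc 2 n))

signedDownUp⋆valleyFree : ∀ w → (signedDownUp ⋆ valleyFree) w ≡ valleyFree w - ε w
signedDownUp⋆valleyFree [] = refl
signedDownUp⋆valleyFree (x ∷ []) = refl
signedDownUp⋆valleyFree (x ∷ y ∷ []) = refl
signedDownUp⋆valleyFree (x ∷ y ∷ z ∷ r) = begin
  (signedDownUp ⋆ valleyFree) (x ∷ y ∷ z ∷ r)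
    ≡⟨ ⋆-∷₀ signedDownUp valleyFree x (y ∷ z ∷ r) refl ⟩
  ((signedDownUp ∘ (x ∷_)) ⋆ valleyFree) (y ∷ z ∷ r)
    ≡⟨ ⋆-∷ (signedDownUp ∘ (x ∷_)) valleyFree y (z ∷ r) ⟩
  1ℤ *ℤ valleyFree (y ∷ z ∷ r) + ((signedDownUp ∘ (x ∷_) ∘ (y ∷_)) ⋆ valleyFree) (z ∷ r)
    ≡⟨ cong (1ℤ *ℤ valleyFree (y ∷ z ∷ r) +_) (⋆-∷₀ (signedDownUp ∘ (x ∷_) ∘ (y ∷_)) valleyFree z r refl) ⟩
  1ℤ *ℤ valleyFree (y ∷ z ∷ r) + ((λ a → - v *ℤ signedDownUp (z ∷ a)) ⋆ valleyFree) r
    ≡⟨ cong (1ℤ *ℤ valleyFree (y ∷ z ∷ r) +_) (⋆-*ˡ (- v) (signedDownUp ∘ (z ∷_)) valleyFree r) ⟩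
  1ℤ *ℤ valleyFree (y ∷ z ∷ r) + - v *ℤ ((signedDownUp ∘ (z ∷_)) ⋆ valleyFree) r
    ≡⟨ cong (λ t → 1ℤ *ℤ valleyFree (y ∷ z ∷ r) + - v *ℤ t) (sym (⋆-∷₀ signedDownUp valleyFree z r refl)) ⟩
  1ℤ *ℤ valleyFree (y ∷ z ∷ r) + - v *ℤ (signedDownUp ⋆ valleyFree) (z ∷ r)
    ≡⟨ cong (λ t → 1ℤ *ℤ valleyFree (y ∷ z ∷ r) + - v *ℤ t) (signedDownUp⋆valleyFree (z ∷ r)) ⟩
  1ℤ *ℤ valleyFree (y ∷ z ∷ r) + - v *ℤ (valleyFree (z ∷ r) - 0ℤ)
    ≡⟨ rearrange (valleyFree (y ∷ z ∷ r)) (valleyFree (z ∷ r)) v ⟩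
  valleyFree (y ∷ z ∷ r) - v *ℤ valleyFree (z ∷ r)
    ≡⟨ valleyFree-recurrence x y z r (valley? x y z) ⟩
  valleyFree (x ∷ y ∷ z ∷ r)
    ≡⟨ sym (ℤ.+-identityʳ _) ⟩
  valleyFree (x ∷ y ∷ z ∷ r) - 0ℤ
    ∎
  where
  open ≡-Reasoning
  v : ℤ
  v = 𝟙 (valley? x y z)
  rearrange : ∀ a b c → 1ℤ *ℤ a + - c *ℤ (b - 0ℤ) ≡ a - c *ℤ b
  rearrange = solve-∀

valleyFree⋆signedDownUp : ∀ w → (valleyFree ⋆ signedDownUp) w ≡ valleyFree w - ε w
valleyFree⋆signedDownUp w = begin
  (valleyFree ⋆ signedDownUp) w
    ≡⟨ cong (valleyFree ⋆ signedDownUp) (sym (List.reverse-involutive w)) ⟩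
  (valleyFree ⋆ signedDownUp) (reverse (reverse w))
    ≡⟨ ⋆-reverse valleyFree signedDownUp (reverse w) ⟩
  ((signedDownUp ∘ reverse) ⋆ (valleyFree ∘ reverse)) (reverse w)
    ≡⟨ ⋆-cong₂ (reverse w) (λ a _ _ → signedDownUp-reverse a) (λ _ b _ → valleyFree-reverse b) ⟩
  (signedDownUp ⋆ valleyFree) (reverse w)
    ≡⟨ signedDownUp⋆valleyFree (reverse w) ⟩
  valleyFree (reverse w) - ε (reverse w)
    ≡⟨ cong₂ _-_ (valleyFree-reverse w) (ε-reverse w) ⟩
  valleyFree w - ε w
    ∎
  where open ≡-Reasoning

oddValleyFree⋆signedDownUp : ∀ y → (oddValleyFree ⋆ signedDownUp) y ≡ 𝟙 (even? y) *ℤ valleyFree y - ε y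
oddValleyFree⋆signedDownUp y = begin
  (oddValleyFree ⋆ signedDownUp) y
    ≡⟨ ⋆-cong {F = oddValleyFree} {G = signedDownUp} {F′ = λ u → 𝟙 (even? y) *ℤ valleyFree u} y
              parity-swap ⟩
  ((λ u → 𝟙 (even? y) *ℤ valleyFree u) ⋆ signedDownUp) y
    ≡⟨ ⋆-*ˡ (𝟙 (even? y)) valleyFree signedDownUp y ⟩
  𝟙 (even? y) *ℤ (valleyFree ⋆ signedDownUp) y
    ≡⟨ cong (𝟙 (even? y) *ℤ_) (valleyFree⋆signedDownUp y) ⟩
  𝟙 (even? y) *ℤ (valleyFree y - ε y)
    ≡⟨ distrib (𝟙 (even? y)) (valleyFree y) (ε y) ⟩
  𝟙 (even? y) *ℤ valleyFree y - 𝟙 (even? y) *ℤ ε y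
    ≡⟨ cong (λ t → 𝟙 (even? y) *ℤ valleyFree y - t) (even-ε y) ⟩
  𝟙 (even? y) *ℤ valleyFree y - ε y
    ∎
  where
  open ≡-Reasoning
  parity-swap : ∀ u b → u ++ b ≡ y →
                oddValleyFree u *ℤ signedDownUp b ≡ 𝟙 (even? y) *ℤ valleyFree u *ℤ signedDownUp b
  parity-swap u b ub≡y = *-signedDownUp-cong b λ b-odd → begin
    oddValleyFree u                    ≡⟨ 𝟙-× (odd? u) (¬? (hasValley? u)) ⟩
    𝟙 (odd? u) *ℤ valleyFree u
      ≡⟨ cong (_*ℤ valleyFree u) (𝟙-⇔ (Odd⇔Even-++ʳ u b b-odd) (odd? u) (even? (u ++ b))) ⟩
    𝟙 (even? (u ++ b)) *ℤ valleyFree u ≡⟨ cong (λ v → 𝟙 (even? v) *ℤ valleyFree u) ub≡y ⟩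
    𝟙 (even? y) *ℤ valleyFree u        ∎
  distrib : ∀ c a b → c *ℤ (a - b) ≡ c *ℤ a - c *ℤ b
  distrib = solve-∀
  even-ε : ∀ y → 𝟙 (even? y) *ℤ ε y ≡ ε y
  even-ε [] = refl
  even-ε (x ∷ w) = ℤ.*-zeroʳ (𝟙 (even? (x ∷ w)))

Φ : (List ℕ → ℤ) → List ℕ → ℤ
Φ T w = oddValleyFree w - (T ⋆ (oddValleyFree ⋆ T)) w

Φ-local : ∀ {T T′} w → T [] ≡ 0ℤ → T′ [] ≡ 0ℤ → (∀ v → length v < length w → T v ≡ T′ v) →
          Φ T w ≡ Φ T′ w
Φ-local {T} {T′} w T₀ T′₀ T≈T′ =
  cong (λ t → oddValleyFree w - t)
    (⋆-local {G = oddValleyFree ⋆ T} {G′ = oddValleyFree ⋆ T′} w T₀ T′₀ refl refl T≈T′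
      (λ v v<w → ⋆-local {F = oddValleyFree} {F′ = oddValleyFree} v refl refl T₀ T′₀ (λ _ _ → refl)
                   (λ u u<v → T≈T′ u (ℕ.<-trans u<v v<w))))

signedDownUp-fixpoint : ∀ w → Φ signedDownUp w ≡ signedDownUp w
signedDownUp-fixpoint w = begin
  oddValleyFree w - (signedDownUp ⋆ (oddValleyFree ⋆ signedDownUp)) w
    ≡⟨ cong (λ t → oddValleyFree w - t)
            (⋆-cong {F = signedDownUp} {F′ = signedDownUp} {G′ = λ y → o *ℤ valleyFree y - ε y} w parity-swap) ⟩
  oddValleyFree w - (signedDownUp ⋆ (λ y → o *ℤ valleyFree y - ε y)) w
    ≡⟨ cong (λ t → oddValleyFree w - t) (⋆-linearʳ o signedDownUp valleyFree ε w) ⟩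
  oddValleyFree w - (o *ℤ (signedDownUp ⋆ valleyFree) w - (signedDownUp ⋆ ε) w)
    ≡⟨ cong₂ (λ s t → oddValleyFree w - (o *ℤ s - t))
             (signedDownUp⋆valleyFree w) (⋆-identityʳ signedDownUp w) ⟩
  oddValleyFree w - (o *ℤ (valleyFree w - ε w) - signedDownUp w)
    ≡⟨ cong (_- (o *ℤ (valleyFree w - ε w) - signedDownUp w)) (𝟙-× (odd? w) (¬? (hasValley? w))) ⟩
  o *ℤ valleyFree w - (o *ℤ (valleyFree w - ε w) - signedDownUp w)
    ≡⟨ rearrange o (valleyFree w) (ε w) (signedDownUp w) ⟩
  o *ℤ ε w + signedDownUp w
    ≡⟨ cong (_+ signedDownUp w) (odd-ε w) ⟩
  0ℤ + signedDownUp w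
    ≡⟨ ℤ.+-identityˡ (signedDownUp w) ⟩
  signedDownUp w
    ∎
  where
  open ≡-Reasoning
  o : ℤ
  o = 𝟙 (odd? w)
  parity-swap : ∀ a y → a ++ y ≡ w →
                signedDownUp a *ℤ (oddValleyFree ⋆ signedDownUp) y
                  ≡ signedDownUp a *ℤ (o *ℤ valleyFree y - ε y)
  parity-swap a y ay≡w = trans (cong (signedDownUp a *ℤ_) (oddValleyFree⋆signedDownUp y))
    (signedDownUp-*-cong a λ a-odd → cong (λ c → c *ℤ valleyFree y - ε y)
      (trans (𝟙-⇔ (Even⇔Odd-++ˡ a y a-odd) (even? y) (odd? (a ++ y))) (cong (𝟙 ∘ odd?) ay≡w)))
  rearrange : ∀ o x e f → o *ℤ x - (o *ℤ (x - e) - f) ≡ o *ℤ e + f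
  rearrange = solve-∀
  odd-ε : ∀ w → 𝟙 (odd? w) *ℤ ε w ≡ 0ℤ
  odd-ε [] = refl
  odd-ε (x ∷ w) = ℤ.*-zeroʳ (𝟙 (odd? (x ∷ w)))

-- Labeled binary trees

internalNodes : Tree → ℕ
internalNodes (leaf _) = 0
internalNodes (node l _ r) = suc (internalNodes l ℕ.+ internalNodes r)

edges≡internalNodes+internalNodes : ∀ T → edges T ≡ internalNodes T ℕ.+ internalNodes T
edges≡internalNodes+internalNodes (leaf _) = refl
edges≡internalNodes+internalNodes (node l _ r)
  rewrite edges≡internalNodes+internalNodes l | edges≡internalNodes+internalNodes r =
  regroup (internalNodes l) (internalNodes r)
  where
  regroup : ∀ m n → m ℕ.+ m ℕ.+ (n ℕ.+ n) ℕ.+ 2 ≡ suc (m ℕ.+ n) ℕ.+ suc (m ℕ.+ n)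
  regroup = ℕ-Ring.solve-∀

h≡internalNodes : ∀ T → h T ≡ internalNodes T
h≡internalNodes T =
  trans (cong ⌊_/2⌋ (edges≡internalNodes+internalNodes T)) (sym (ℕ.n≡⌊n+n/2⌋ (internalNodes T)))

treeSign : Tree → ℤ
treeSign T = sign (h T)

treeSign-node : ∀ l u r → treeSign (node l u r) ≡ -1ℤ *ℤ treeSign l *ℤ treeSign r
treeSign-node l u r rewrite h≡internalNodes (node l u r) | h≡internalNodes l | h≡internalNodes r =
  trans (cong (-1ℤ *ℤ_) (ℤ.^-distribˡ-+-* -1ℤ (internalNodes l) (internalNodes r)))
        (sym (ℤ.*-assoc -1ℤ (sign (internalNodes l)) (sign (internalNodes r))))

leaves : List ℕ → List Tree
leaves w = if does (oddValleyFree? w) then [ leaf w ] else []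

nodes : (List ℕ → List Tree) → List ℕ → List ℕ → List ℕ → List Tree
nodes trees a u b =
  if does (oddValleyFree? u) then cartesianProductWith (λ L R → node L u R) (trees a) (trees b) else []

nodesWithLeft : (List ℕ → List Tree) → List ℕ → List ℕ → List Tree
nodesWithLeft trees a y = concatMap (λ q → nodes trees a (proj₁ q) (proj₂ q)) (splits y)

nodesOver : (List ℕ → List Tree) → List ℕ → List Tree
nodesOver trees w = concatMap (λ p → nodesWithLeft trees (proj₁ p) (proj₂ p)) (splits w)

-- With fuel f the list is complete only for words of length ≤ f (∈-labeledTrees⁺).
labeledTrees : ℕ → List ℕ → List Tree
labeledTrees zero w = []
labeledTrees (suc f) w = leaves w ++ nodesOver (labeledTrees f) w

signedTreeCount : ℕ → List ℕ → ℤ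
signedTreeCount f w = ∑ treeSign (labeledTrees f w)

∑-nodes : ∀ trees a u b →
          ∑ treeSign (nodes trees a u b)
            ≡ -1ℤ *ℤ ∑ treeSign (trees a) *ℤ (oddValleyFree u *ℤ ∑ treeSign (trees b))
∑-nodes trees a u b = begin
  ∑ treeSign (nodes trees a u b)
    ≡⟨ ∑-if (oddValleyFree? u) treeSign _ ⟩
  oddValleyFree u *ℤ ∑ treeSign (cartesianProductWith (λ L R → node L u R) (trees a) (trees b))
    ≡⟨ cong (oddValleyFree u *ℤ_)
         (∑-product treeSign (λ L R → node L u R) (λ L → -1ℤ *ℤ treeSign L) treeSign (trees a) (trees b)
           (λ L R → treeSign-node L u R)) ⟩
  oddValleyFree u *ℤ ((∑[ L ∈ trees a ] -1ℤ *ℤ treeSign L) *ℤ ∑ treeSign (trees b))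
    ≡⟨ cong (λ s → oddValleyFree u *ℤ (s *ℤ ∑ treeSign (trees b))) (∑-*ˡ -1ℤ treeSign (trees a)) ⟩
  oddValleyFree u *ℤ (-1ℤ *ℤ ∑ treeSign (trees a) *ℤ ∑ treeSign (trees b))
    ≡⟨ regroup (oddValleyFree u) (∑ treeSign (trees a)) (∑ treeSign (trees b)) ⟩
  -1ℤ *ℤ ∑ treeSign (trees a) *ℤ (oddValleyFree u *ℤ ∑ treeSign (trees b))
    ∎
  where
  open ≡-Reasoning
  regroup : ∀ o s t → o *ℤ (-1ℤ *ℤ s *ℤ t) ≡ -1ℤ *ℤ s *ℤ (o *ℤ t)
  regroup = solve-∀

signedTreeCount-suc : ∀ f w → signedTreeCount (suc f) w ≡ Φ (signedTreeCount f) w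
signedTreeCount-suc f w = begin
  ∑ treeSign (leaves w ++ nodesOver (labeledTrees f) w)
    ≡⟨ ∑-++ treeSign (leaves w) _ ⟩
  ∑ treeSign (leaves w) + ∑ treeSign (nodesOver (labeledTrees f) w)
    ≡⟨ cong₂ _+_ (trans (∑-if (oddValleyFree? w) treeSign _) (ℤ.*-identityʳ (oddValleyFree w)))
                 ∑-nodesOver ⟩
  oddValleyFree w + -1ℤ *ℤ (S ⋆ (oddValleyFree ⋆ S)) w
    ≡⟨ cong (oddValleyFree w +_) (ℤ.-1*i≡-i _) ⟩
  Φ S w
    ∎
  where
  open ≡-Reasoning
  S : List ℕ → ℤ
  S = signedTreeCount f
  ∑-nodesOver : ∑ treeSign (nodesOver (labeledTrees f) w) ≡ -1ℤ *ℤ (S ⋆ (oddValleyFree ⋆ S)) w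
  ∑-nodesOver = begin
    ∑ treeSign (nodesOver (labeledTrees f) w)
      ≡⟨ ∑-concatMap treeSign _ (splits w) ⟩
    ∑[ p ∈ splits w ] ∑ treeSign (nodesWithLeft (labeledTrees f) (proj₁ p) (proj₂ p))
      ≡⟨ ∑-cong (splits w) (λ {p} _ → begin
           ∑ treeSign (nodesWithLeft (labeledTrees f) (proj₁ p) (proj₂ p))
             ≡⟨ ∑-concatMap treeSign _ (splits (proj₂ p)) ⟩
           ∑[ q ∈ splits (proj₂ p) ] ∑ treeSign (nodes (labeledTrees f) (proj₁ p) (proj₁ q) (proj₂ q))
             ≡⟨ ∑-cong (splits (proj₂ p))
                  (λ {q} _ → ∑-nodes (labeledTrees f) (proj₁ p) (proj₁ q) (proj₂ q)) ⟩
           ∑[ q ∈ splits (proj₂ p) ] -1ℤ *ℤ S (proj₁ p) *ℤ (oddValleyFree (proj₁ q) *ℤ S (proj₂ q))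
             ≡⟨ ∑-*ˡ (-1ℤ *ℤ S (proj₁ p)) _ (splits (proj₂ p)) ⟩
           -1ℤ *ℤ S (proj₁ p) *ℤ (oddValleyFree ⋆ S) (proj₂ p)
             ∎) ⟩
    ((λ a → -1ℤ *ℤ S a) ⋆ (oddValleyFree ⋆ S)) w
      ≡⟨ ⋆-*ˡ -1ℤ S (oddValleyFree ⋆ S) w ⟩
    -1ℤ *ℤ (S ⋆ (oddValleyFree ⋆ S)) w
      ∎

labeledTrees-[] : ∀ f → labeledTrees f [] ≡ []
labeledTrees-[] zero = refl
labeledTrees-[] (suc f) = refl

signedTreeCount≡signedDownUp : ∀ f w → length w ≤ f → signedTreeCount f w ≡ signedDownUp w
signedTreeCount≡signedDownUp zero [] _ = refl
signedTreeCount≡signedDownUp (suc f) w |w|≤1+f = begin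
  signedTreeCount (suc f) w  ≡⟨ signedTreeCount-suc f w ⟩
  Φ (signedTreeCount f) w    ≡⟨ Φ-local w (cong (∑ treeSign) (labeledTrees-[] f)) refl shorter ⟩
  Φ signedDownUp w           ≡⟨ signedDownUp-fixpoint w ⟩
  signedDownUp w             ∎
  where
  open ≡-Reasoning
  shorter : ∀ v → length v < length w → signedTreeCount f v ≡ signedDownUp v
  shorter v v<w = signedTreeCount≡signedDownUp f v (ℕ.≤-pred (ℕ.≤-trans v<w |w|≤1+f))

data NodeOf (trees : List ℕ → List Tree) (a u b : List ℕ) : Tree → Set where
  node∈ : ∀ {L R} → OddValleyFree u → L ∈ trees a → R ∈ trees b → NodeOf trees a u b (node L u R)

∈-nodes⁻ : ∀ trees a u b {T} → T ∈ nodes trees a u b → NodeOf trees a u b T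
∈-nodes⁻ trees a u b T∈ with ∈-if⁻ (oddValleyFree? u) T∈
... | ovf , T∈product with ∈-cartesianProductWith⁻ (λ L R → node L u R) (trees a) (trees b) T∈product
... | L , R , L∈ , R∈ , refl = node∈ ovf L∈ R∈

∈-nodesOver⁻ : ∀ trees w {T} → T ∈ nodesOver trees w →
               ∃ λ a → ∃ λ u → ∃ λ b → a ++ u ++ b ≡ w × NodeOf trees a u b T
∈-nodesOver⁻ trees w T∈ with find (∈-concatMap⁻ _ {xs = splits w} T∈)
... | (a , y) , ay∈ , T∈′ with find (∈-concatMap⁻ _ {xs = splits y} T∈′)
... | (u , b) , ub∈ , T∈″ =
  a , u , b , trans (cong (a ++_) (∈-splits⁻ y ub∈)) (∈-splits⁻ w ay∈) , ∈-nodes⁻ trees a u b T∈″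

∈-nodesOver⁺ : ∀ trees {a u b L R} → OddValleyFree u → L ∈ trees a → R ∈ trees b →
               node L u R ∈ nodesOver trees (a ++ u ++ b)
∈-nodesOver⁺ trees {a} {u} {b} ovf L∈ R∈ =
  ∈-concatMap⁺ _ (lose (∈-splits⁺ a (u ++ b))
    (∈-concatMap⁺ _ (lose (∈-splits⁺ u b)
      (∈-if⁺ (oddValleyFree? u) ovf (∈-cartesianProductWith⁺ (λ L R → node L u R) L∈ R∈)))))

nodesOver-unique : ∀ trees w → (∀ v → Unique (trees v)) → (∀ v {T} → T ∈ trees v → word T ≡ v) →
                   Unique (nodesOver trees w)
nodesOver-unique trees w trees! word≡ =
  concatMap-unique _ outerKey (splits-unique w)
    (λ p → concatMap-unique _ innerKey (splits-unique (proj₂ p)) (λ q → nodes-unique _ _ _)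
                            (innerKey-nodes (proj₁ p)))
    outerKey-nodes
  where
  outerKey innerKey : Tree → List ℕ × List ℕ
  outerKey (leaf u) = [] , u
  outerKey (node L u R) = word L , u ++ word R
  innerKey (leaf u) = u , []
  innerKey (node L u R) = u , word R
  node-injective : ∀ {u L L′ R R′} → node L u R ≡ node L′ u R′ → L ≡ L′ × R ≡ R′
  node-injective refl = refl , refl
  nodes-unique : ∀ a u b → Unique (nodes trees a u b)
  nodes-unique a u b = if-unique (oddValleyFree? u)
    (Unique.cartesianProductWith⁺ (λ L R → node L u R) node-injective (trees! a) (trees! b))
  innerKey-nodes : ∀ a q {T} → T ∈ nodes trees a (proj₁ q) (proj₂ q) → innerKey T ≡ q
  innerKey-nodes a (u , b) T∈ with ∈-nodes⁻ trees a u b T∈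
  ... | node∈ _ _ R∈ = cong (u ,_) (word≡ b R∈)
  outerKey-nodes : ∀ p {T} → T ∈ nodesWithLeft trees (proj₁ p) (proj₂ p) → outerKey T ≡ p
  outerKey-nodes (a , y) T∈ with find (∈-concatMap⁻ _ {xs = splits y} T∈)
  ... | (u , b) , ub∈ , T∈′ with ∈-nodes⁻ trees a u b T∈′
  ... | node∈ _ L∈ R∈ = cong₂ _,_ (word≡ a L∈) (trans (cong (u ++_) (word≡ b R∈)) (∈-splits⁻ y ub∈))

∈-labeledTrees⁻ : ∀ f w {T} → T ∈ labeledTrees f w → word T ≡ w × AllLabels OddValleyFree T
∈-labeledTrees⁻ (suc f) w T∈ with ∈-++⁻ (leaves w) T∈
... | inj₁ T∈leaves = leaf-case (∈-if⁻ (oddValleyFree? w) T∈leaves)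
  where
  leaf-case : ∀ {T} → OddValleyFree w × T ∈ [ leaf w ] → word T ≡ w × AllLabels OddValleyFree T
  leaf-case (ovf , here refl) = refl , ovf
... | inj₂ T∈nodes with ∈-nodesOver⁻ (labeledTrees f) w T∈nodes
... | a , u , b , aub≡w , node∈ ovf L∈ R∈ with ∈-labeledTrees⁻ f a L∈ | ∈-labeledTrees⁻ f b R∈
... | wL≡a , L-labels | wR≡b , R-labels =
  trans (cong₂ (λ s t → s ++ u ++ t) wL≡a wR≡b) aub≡w , L-labels , ovf , R-labels

∈-labeledTrees⁺ : ∀ f T → length (word T) ≤ f → AllLabels OddValleyFree T → T ∈ labeledTrees f (word T)
∈-labeledTrees⁺ zero (leaf u) |u|≤0 (u-odd , _) with () ← ℕ.<-≤-trans (Odd⇒0<length u u-odd) |u|≤0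
∈-labeledTrees⁺ zero (node L u R) |T|≤0 (_ , (u-odd , _) , _)
  with () ← ℕ.<-≤-trans (length-<-++-middleˡ (word L) u (word R) (Odd⇒0<length u u-odd)) |T|≤0
∈-labeledTrees⁺ (suc f) (leaf u) _ ovf = ∈-++⁺ˡ (∈-if⁺ (oddValleyFree? u) ovf (here refl))
∈-labeledTrees⁺ (suc f) (node L u R) |T|≤1+f (L-labels , ovf , R-labels) =
  ∈-++⁺ʳ (leaves (word (node L u R)))
    (∈-nodesOver⁺ (labeledTrees f) ovf
      (∈-labeledTrees⁺ f L (shrink (length-<-++-middleˡ (word L) u (word R) 0<u)) L-labels)
      (∈-labeledTrees⁺ f R (shrink (length-<-++-middleʳ (word L) u (word R) 0<u)) R-labels))
  where
  0<u : 0 < length u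
  0<u = Odd⇒0<length u (proj₁ ovf)
  shrink : ∀ {n} → n < length (word (node L u R)) → n ≤ f
  shrink n< = ℕ.≤-pred (ℕ.≤-trans n< |T|≤1+f)

labeledTrees-unique : ∀ f w → Unique (labeledTrees f w)
labeledTrees-unique zero w = []
labeledTrees-unique (suc f) w =
  Unique.++⁺ (if-unique (oddValleyFree? w) ([] ∷ []))
             (nodesOver-unique (labeledTrees f) w (labeledTrees-unique f)
                               (λ v T∈ → proj₁ (∈-labeledTrees⁻ f v T∈)))
             leaf∉nodes
  where
  leaf∉nodes : Disjoint (leaves w) (nodesOver (labeledTrees f) w)
  leaf∉nodes (T∈leaves , T∈nodes) with ∈-if⁻ (oddValleyFree? w) T∈leaves
  ... | _ , here refl with ∈-nodesOver⁻ (labeledTrees f) w T∈nodes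
  ... | _ , _ , _ , _ , ()

AllLabels-map : ∀ {P Q : List ℕ → Set} → (∀ {u} → P u → Q u) → ∀ T → AllLabels P T → AllLabels Q T
AllLabels-map P⇒Q (leaf _) p = P⇒Q p
AllLabels-map P⇒Q (node l _ r) (pl , pu , pr) = AllLabels-map P⇒Q l pl , P⇒Q pu , AllLabels-map P⇒Q r pr

AllLabels-zip : ∀ {P Q R : List ℕ → Set} → (∀ {u} → P u → Q u → R u) →
                ∀ T → AllLabels P T → AllLabels Q T → AllLabels R T
AllLabels-zip PQ⇒R (leaf _) p q = PQ⇒R p q
AllLabels-zip PQ⇒R (node l _ r) (pl , pu , pr) (ql , qu , qr) =
  AllLabels-zip PQ⇒R l pl ql , PQ⇒R pu qu , AllLabels-zip PQ⇒R r pr qr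

AllLabels-Unique : ∀ T → Unique (word T) → AllLabels Unique T
AllLabels-Unique (leaf _) w! = w!
AllLabels-Unique (node l u r) w! with Unique-++⁻ (word l) w!
... | l! , ur! with Unique-++⁻ u ur!
... | u! , r! = AllLabels-Unique l l! , u! , AllLabels-Unique r r!

OddUnimodal⇔OddValleyFree : ∀ T → Unique (word T) → AllLabels OddUnimodal T ⇔ AllLabels OddValleyFree T
OddUnimodal⇔OddValleyFree T w! =
  mk⇔ (AllLabels-map OddUnimodal⇒OddValleyFree T)
      (AllLabels-zip OddValleyFree⇒OddUnimodal T (AllLabels-Unique T w!))

comb : List ℕ → Tree
comb [] = leaf []
comb (x ∷ []) = leaf [ x ]
comb (x ∷ y ∷ r) = node (leaf [ x ]) [ y ] (comb r)

comb-word : ∀ w → Odd w → word (comb w) ≡ w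
comb-word (x ∷ []) _ = refl
comb-word (x ∷ y ∷ r) r-odd = cong (λ v → x ∷ y ∷ v) (comb-word r r-odd)

singleton-OddUnimodal : ∀ x → OddUnimodal [ x ]
singleton-OddUnimodal x = (1 , s≤s z≤n , s≤s z≤n , [-] , [-]) , 0 , refl

comb-labels : ∀ w → Odd w → AllLabels OddUnimodal (comb w)
comb-labels (x ∷ []) _ = singleton-OddUnimodal x
comb-labels (x ∷ y ∷ r) r-odd = singleton-OddUnimodal x , singleton-OddUnimodal y , comb-labels r r-odd

interval-unique : ∀ m → Unique (interval m)
interval-unique m = Unique.map⁺ ℕ.suc-injective (Unique.upTo⁺ m)

↭-interval⇒Unique : ∀ {w m} → w ↭ interval m → Unique w
↭-interval⇒Unique {m = m} w↭ = ↭ₛ.Unique-resp-↭ (setoid ℕ) (↭⇒↭ₛ (↭-sym w↭)) (interval-unique m)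

↭-interval⇒length : ∀ {w m} → w ↭ interval m → length w ≡ m
↭-interval⇒length {m = m} w↭ = trans (↭-length w↭) (trans (List.length-map suc (upTo m)) (List.length-upTo m))

-- The permutations of [2n+1] are read off the given enumeration of LB n as the words of its trees;
-- comb trees show that every down-up permutation is among them.
wordsOf : List Tree → List (List ℕ)
wordsOf ts = deduplicate (List.≡-dec ℕ._≟_) (map word ts)

labeledTreesOver : List (List ℕ) → List Tree
labeledTreesOver = concatMap (λ w → labeledTrees (length w) w)

∑-labeledTreesOver : ∀ k W → ∑[ T ∈ labeledTreesOver W ] 𝟙 (inv (word T) ℕ.≟ k) *ℤ treeSign T
                        ≡ ∑[ w ∈ W ] 𝟙 (inv w ℕ.≟ k) *ℤ signedDownUp w
∑-labeledTreesOver k W = trans (∑-concatMap _ _ W) (∑-cong W (λ {w} _ → trees-of w))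
  where
  open ≡-Reasoning
  trees-of : ∀ w → ∑[ T ∈ labeledTrees (length w) w ] 𝟙 (inv (word T) ℕ.≟ k) *ℤ treeSign T
                   ≡ 𝟙 (inv w ℕ.≟ k) *ℤ signedDownUp w
  trees-of w = begin
    ∑[ T ∈ labeledTrees (length w) w ] 𝟙 (inv (word T) ℕ.≟ k) *ℤ treeSign T
      ≡⟨ ∑-cong (labeledTrees (length w) w)
           (λ {T} T∈ → cong (λ v → 𝟙 (inv v ℕ.≟ k) *ℤ treeSign T)
                             (proj₁ (∈-labeledTrees⁻ (length w) w T∈))) ⟩
    ∑[ T ∈ labeledTrees (length w) w ] 𝟙 (inv w ℕ.≟ k) *ℤ treeSign T
      ≡⟨ ∑-*ˡ (𝟙 (inv w ℕ.≟ k)) treeSign (labeledTrees (length w) w) ⟩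
    𝟙 (inv w ℕ.≟ k) *ℤ signedTreeCount (length w) w
      ≡⟨ cong (𝟙 (inv w ℕ.≟ k) *ℤ_) (signedTreeCount≡signedDownUp (length w) w ℕ.≤-refl) ⟩
    𝟙 (inv w ℕ.≟ k) *ℤ signedDownUp w
      ∎

module _ (n : ℕ) {ts : List Tree} (ts-enum : Enumerates ts (LB n)) where

  private
    I : List ℕ
    I = interval (suc (2 * n))

  ∈-wordsOf⁻ : ∀ {w} → w ∈ wordsOf ts → w ↭ I
  ∈-wordsOf⁻ w∈ with ∈-map⁻ word (∈-deduplicate⁻ (List.≡-dec ℕ._≟_) (map word ts) w∈)
  ... | T , T∈ , refl = proj₂ (Equivalence.to (proj₂ ts-enum T) T∈)

  ∈-wordsOf⁺ : ∀ T → LB n T → word T ∈ wordsOf ts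
  ∈-wordsOf⁺ T lb = ∈-deduplicate⁺ (List.≡-dec ℕ._≟_) (∈-map⁺ word (Equivalence.from (proj₂ ts-enum T) lb))

  wordsOf-unique : Unique (wordsOf ts)
  wordsOf-unique = UniqueDec.deduplicate-! (List.≡-dec ℕ._≟_) (map word ts)

  labeledTreesOver-wordsOf-enumerates : Enumerates (labeledTreesOver (wordsOf ts)) (LB n)
  labeledTreesOver-wordsOf-enumerates =
    concatMap-unique _ word wordsOf-unique (λ w → labeledTrees-unique (length w) w)
      (λ w T∈ → proj₁ (∈-labeledTrees⁻ (length w) w T∈)) ,
    λ T → mk⇔ sound (complete T)
    where
    sound : ∀ {T} → T ∈ labeledTreesOver (wordsOf ts) → LB n T
    sound {T} T∈ with find (∈-concatMap⁻ _ {xs = wordsOf ts} T∈)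
    ... | w , w∈ , T∈′ with ∈-labeledTrees⁻ (length w) w T∈′
    ... | refl , labels =
      Equivalence.from (OddUnimodal⇔OddValleyFree T (↭-interval⇒Unique (∈-wordsOf⁻ w∈))) labels ,
      ∈-wordsOf⁻ w∈
    complete : ∀ T → LB n T → T ∈ labeledTreesOver (wordsOf ts)
    complete T lb@(labels , _) =
      ∈-concatMap⁺ _ (lose (∈-wordsOf⁺ T lb)
        (∈-labeledTrees⁺ (length (word T)) T ℕ.≤-refl (AllLabels-map OddUnimodal⇒OddValleyFree T labels)))

  filter-alt-wordsOf-enumerates : Enumerates (filter (alt? true) (wordsOf ts)) (DownUpPerm (suc (2 * n)))
  filter-alt-wordsOf-enumerates = Unique.filter⁺ (alt? true) wordsOf-unique , λ π → mk⇔ sound (complete π)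
    where
    sound : ∀ {π} → π ∈ filter (alt? true) (wordsOf ts) → DownUpPerm (suc (2 * n)) π
    sound π∈ with ∈-filter⁻ (alt? true) {xs = wordsOf ts} π∈
    ... | π∈W , down-up = ∈-wordsOf⁻ π∈W , down-up
    complete : ∀ π → DownUpPerm (suc (2 * n)) π → π ∈ filter (alt? true) (wordsOf ts)
    complete π (π↭I , down-up) =
      ∈-filter⁺ (alt? true) (subst (_∈ wordsOf ts) (comb-word π π-odd) comb∈) down-up
      where
      π-odd : Odd π
      π-odd = length≡1+2k⇒Odd π {n} (↭-interval⇒length π↭I)
      comb∈ : word (comb π) ∈ wordsOf ts
      comb∈ = ∈-wordsOf⁺ (comb π) (comb-labels π π-odd , subst (_↭ I) (sym (comb-word π π-odd)) π↭I)

  ∑-wordsOf : ∀ k → ∑[ w ∈ wordsOf ts ] 𝟙 (inv w ℕ.≟ k) *ℤ signedDownUp w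
                    ≡ sign n *ℤ (∑[ π ∈ filter (alt? true) (wordsOf ts) ] 𝟙 (inv π ℕ.≟ k) *ℤ 1ℤ)
  ∑-wordsOf k = begin
    ∑[ w ∈ wordsOf ts ] 𝟙 (inv w ℕ.≟ k) *ℤ signedDownUp w
      ≡⟨ ∑-cong (wordsOf ts) (λ {w} w∈ → trans
           (cong (𝟙 (inv w ℕ.≟ k) *ℤ_) (signedDownUp-alt n w (↭-interval⇒length (∈-wordsOf⁻ w∈))))
           (regroup (𝟙 (inv w ℕ.≟ k)) (sign n) (𝟙 (alt? true w)))) ⟩
    ∑[ w ∈ wordsOf ts ] sign n *ℤ (𝟙 (alt? true w) *ℤ (𝟙 (inv w ℕ.≟ k) *ℤ 1ℤ))
      ≡⟨ ∑-*ˡ (sign n) _ (wordsOf ts) ⟩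
    sign n *ℤ (∑[ w ∈ wordsOf ts ] 𝟙 (alt? true w) *ℤ (𝟙 (inv w ℕ.≟ k) *ℤ 1ℤ))
      ≡⟨ cong (sign n *ℤ_) (sym (∑-filter (alt? true) _ (wordsOf ts))) ⟩
    sign n *ℤ (∑[ π ∈ filter (alt? true) (wordsOf ts) ] 𝟙 (inv π ℕ.≟ k) *ℤ 1ℤ)
      ∎
    where
    open ≡-Reasoning
    regroup : ∀ i s a → i *ℤ (s *ℤ a) ≡ s *ℤ (a *ℤ (i *ℤ 1ℤ))
    regroup = solve-∀

lemma4p4 : (n : ℕ) (ts : List Tree) (ps : List (List ℕ)) →
           Enumerates ts (LB n) →
           Enumerates ps (DownUpPerm (suc (2 * n))) →
           (k : ℕ) →
           genPoly ts (λ T → sign (h T)) (λ T → inv (word T)) k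
             ≡ sign n *ℤ qTangent ps k
lemma4p4 n ts ps ts-enum ps-enum k = begin
  genPoly ts (λ T → sign (h T)) (λ T → inv (word T)) k
    ≡⟨ genPoly≡∑ ts _ _ k ⟩
  ∑[ T ∈ ts ] 𝟙 (inv (word T) ℕ.≟ k) *ℤ treeSign T
    ≡⟨ ∑-Enumerates _ ts-enum (labeledTreesOver-wordsOf-enumerates n ts-enum) ⟩
  ∑[ T ∈ labeledTreesOver (wordsOf ts) ] 𝟙 (inv (word T) ℕ.≟ k) *ℤ treeSign T
    ≡⟨ ∑-labeledTreesOver k (wordsOf ts) ⟩
  ∑[ w ∈ wordsOf ts ] 𝟙 (inv w ℕ.≟ k) *ℤ signedDownUp w
    ≡⟨ ∑-wordsOf n ts-enum k ⟩
  sign n *ℤ (∑[ π ∈ filter (alt? true) (wordsOf ts) ] 𝟙 (inv π ℕ.≟ k) *ℤ 1ℤ)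
    ≡⟨ cong (sign n *ℤ_) (∑-Enumerates _ (filter-alt-wordsOf-enumerates n ts-enum) ps-enum) ⟩
  sign n *ℤ (∑[ π ∈ ps ] 𝟙 (inv π ℕ.≟ k) *ℤ 1ℤ)
    ≡⟨ cong (sign n *ℤ_) (sym (genPoly≡∑ ps _ inv k)) ⟩
  sign n *ℤ qTangent ps k
    ∎
  where open ≡-Reasoning
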